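{- Let $x=(x(n))_{n\geq 1}$ be a sequence of positive integers that is unbounded above, let $y=(y(n))_{n\geq 1}$ be a sequence of positive integers, and let $(B_n)_{n\geq 0}$ be the factorial set associated with $(x,y)$ (defined in the context). If $n!$ divides $B_n$ for all $n\geq 0$, then $(B_n)_{n\geq 0}$ is a generalized factorial, i.e. $B_0=1$, $B_n$ is a positive integer for every $n$, $\frac{B_n}{B_kB_{n-k}}$ is a positive integer for all integers $0\leq k\leq n$, and $n!\mid B_n$ for every $n\geq 1$.
   Context: $\mathrm{Im}(x)$ denotes the set of values of $x$. Define an array $x(n,k)$, $n,k\geq 1$, recursively by: $x(1,1)=\min \mathrm{Im}(x)$; $x(n,k)=0$ whenever $n<k$; and otherwise $x(n,k)$ is the smallest $a\in\mathrm{Im}(x)$ such that $x(i,k)+x(n-i,k)\leq a$ for all $1\leq i\leq n-1$. The factorial set associated with $(x,y)$ is $B_0=1$ and, for $n\geq 1$, $B_n=\prod_{k=1}^{n} y(k)^{x(n,k)}$. -}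

module Defs where

open import Data.Nat using (ℕ; zero; suc; _+_; _*_; _∸_; _^_; _≤_; _<_)
open import Data.Product using (Σ; ∃; _×_; _,_)
open import Relation.Binary.PropositionalEquality using (_≡_)
open import Relation.Nullary using (¬_)

-- Sequences x(n), n ≥ 1, are modelled as functions ℕ → ℕ; the value at 0 is ignored.

InIm : (ℕ → ℕ) → ℕ → Set
InIm x a = ∃ λ n → 1 ≤ n × x n ≡ a

Positive : (ℕ → ℕ) → Set
Positive x = ∀ n → 1 ≤ n → 0 < x n

UnboundedAbove : (ℕ → ℕ) → Set
UnboundedAbove x = ∀ M → ∃ λ n → 1 ≤ n × M < x n

IsLeast : (ℕ → Set) → ℕ → Set
IsLeast P a = P a × (∀ b → P b → a ≤ b)

-- X is the array x(n,k) (n,k ≥ 1) defined recursively from x, as in the paper: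
--  x(1,1) = min Im(x); x(n,k) = 0 if n < k; otherwise x(n,k) is the smallest
--  a ∈ Im(x) with x(i,k) + x(n-i,k) ≤ a for all 1 ≤ i ≤ n-1.
-- Values at n = 0 or k = 0 are irrelevant.
IsArray : (ℕ → ℕ) → (ℕ → ℕ → ℕ) → Set
IsArray x X =
  IsLeast (InIm x) (X 1 1)
  × (∀ n k → 1 ≤ n → 1 ≤ k → n < k → X n k ≡ 0)
  × (∀ n k → 1 ≤ n → 1 ≤ k → k ≤ n → ¬ (n ≡ 1 × k ≡ 1) →
       IsLeast (λ a → InIm x a × (∀ i → 1 ≤ i → i ≤ n ∸ 1 → X i k + X (n ∸ i) k ≤ a))
               (X n k))

prod1 : (ℕ → ℕ) → ℕ → ℕ
prod1 f zero    = 1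
prod1 f (suc n) = prod1 f n * f (suc n)

FactorialSet : (ℕ → ℕ → ℕ) → (ℕ → ℕ) → ℕ → ℕ
FactorialSet X y n = prod1 (λ k → y k ^ X n k) n

module Submission where

open import Defs
open import Data.Nat using (ℕ; _*_; _∸_; _≤_; _<_; _!)
open import Data.Nat.Divisibility using (_∣_)
open import Data.Product using (∃; _×_)
open import Relation.Binary.PropositionalEquality using (_≡_)

open import Data.Nat using (zero; suc; _+_; _^_; z≤n; s≤s; >-nonZero)
open import Data.Nat.Properties
open import Algebra.Properties.CommutativeSemigroup *-commutativeSemigroup using (interchange)
open import Data.Product using (_,_; proj₁; proj₂)
open import Data.Sum using (inj₁; inj₂)
open import Relation.Nullary using (¬_)
open import Relation.Binary.PropositionalEquality using (refl; sym; trans; cong; cong₂; module ≡-Reasoning)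

-- The superadditivity x(k,j) + x(n-k,j) ≤ x(n,j) built into the array makes every
-- exponent of B_n / (B_k B_{n-k}) nonnegative, so the quotient is a product of powers
-- of the y(j).

prod1-positive : ∀ f n → (∀ j → 1 ≤ j → j ≤ n → 0 < f j) → 0 < prod1 f n
prod1-positive f zero    f>0 = s≤s z≤n
prod1-positive f (suc n) f>0 =
  *-mono-≤ (prod1-positive f n (λ j 1≤j j≤n → f>0 j 1≤j (m≤n⇒m≤1+n j≤n)))
           (f>0 (suc n) (s≤s z≤n) ≤-refl)

prod1-cong : ∀ f g n → (∀ j → 1 ≤ j → j ≤ n → f j ≡ g j) → prod1 f n ≡ prod1 g n
prod1-cong f g zero    f≡g = refl
prod1-cong f g (suc n) f≡g =
  cong₂ _*_ (prod1-cong f g n (λ j 1≤j j≤n → f≡g j 1≤j (m≤n⇒m≤1+n j≤n)))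
            (f≡g (suc n) (s≤s z≤n) ≤-refl)

prod1-distrib-* : ∀ f g n → prod1 (λ j → f j * g j) n ≡ prod1 f n * prod1 g n
prod1-distrib-* f g zero    = refl
prod1-distrib-* f g (suc n) =
  trans (cong (_* (f (suc n) * g (suc n))) (prod1-distrib-* f g n))
        (interchange (prod1 f n) (prod1 g n) (f (suc n)) (g (suc n)))

prod1-trailing-ones : ∀ f {m n} → m ≤ n → (∀ j → m < j → j ≤ n → f j ≡ 1) →
                      prod1 f n ≡ prod1 f m
prod1-trailing-ones f {n = zero}  z≤n  _    = refl
prod1-trailing-ones f {m} {suc n} m≤1+n ones with m≤n⇒m<n∨m≡n m≤1+n
... | inj₂ refl      = refl
... | inj₁ (s≤s m≤n) = begin
  prod1 f n * f (suc n) ≡⟨ cong (prod1 f n *_) (ones (suc n) (s≤s m≤n) ≤-refl) ⟩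
  prod1 f n * 1         ≡⟨ *-identityʳ (prod1 f n) ⟩
  prod1 f n             ≡⟨ prod1-trailing-ones f m≤n (λ j m<j j≤n → ones j m<j (m≤n⇒m≤1+n j≤n)) ⟩
  prod1 f m             ∎
  where open ≡-Reasoning

^-positive : ∀ {a} → 0 < a → ∀ e → 0 < a ^ e
^-positive {a} a>0 = m^n>0 a {{>-nonZero a>0}}

^-split : ∀ a {e f g} → e + f ≤ g → a ^ g ≡ a ^ (g ∸ (e + f)) * (a ^ e * a ^ f)
^-split a {e} {f} {g} e+f≤g = begin
  a ^ g                                ≡⟨ cong (a ^_) (sym (m∸n+n≡m e+f≤g)) ⟩
  a ^ (g ∸ (e + f) + (e + f))          ≡⟨ ^-distribˡ-+-* a (g ∸ (e + f)) (e + f) ⟩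
  a ^ (g ∸ (e + f)) * a ^ (e + f)      ≡⟨ cong (a ^ (g ∸ (e + f)) *_) (^-distribˡ-+-* a e f) ⟩
  a ^ (g ∸ (e + f)) * (a ^ e * a ^ f)  ∎
  where open ≡-Reasoning

prod1-^-split : ∀ (a e f g : ℕ → ℕ) n → (∀ j → 1 ≤ j → j ≤ n → e j + f j ≤ g j) →
                prod1 (λ j → a j ^ g j) n
                  ≡ prod1 (λ j → a j ^ (g j ∸ (e j + f j))) n
                    * (prod1 (λ j → a j ^ e j) n * prod1 (λ j → a j ^ f j) n)
prod1-^-split a e f g n e+f≤g = begin
  prod1 (λ j → a j ^ g j) n
    ≡⟨ prod1-cong _ _ n (λ j 1≤j j≤n → ^-split (a j) {e j} {f j} (e+f≤g j 1≤j j≤n)) ⟩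
  prod1 (λ j → a j ^ (g j ∸ (e j + f j)) * (a j ^ e j * a j ^ f j)) n
    ≡⟨ prod1-distrib-* _ _ n ⟩
  prod1 (λ j → a j ^ (g j ∸ (e j + f j))) n * prod1 (λ j → a j ^ e j * a j ^ f j) n
    ≡⟨ cong (prod1 (λ j → a j ^ (g j ∸ (e j + f j))) n *_) (prod1-distrib-* _ _ n) ⟩
  prod1 (λ j → a j ^ (g j ∸ (e j + f j))) n
    * (prod1 (λ j → a j ^ e j) n * prod1 (λ j → a j ^ f j) n)
    ∎
  where open ≡-Reasoning

module _ {x : ℕ → ℕ} {X : ℕ → ℕ → ℕ} (array : IsArray x X) where

  array-superadditive : ∀ {i n k} → 1 ≤ i → i < n → 1 ≤ k → k ≤ n →
                        X i k + X (n ∸ i) k ≤ X n k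
  array-superadditive {i} {suc n} {k} 1≤i (s≤s i≤n) 1≤k k≤1+n =
    proj₂ (proj₁ (proj₂ (proj₂ array) (suc n) _ (s≤s z≤n) 1≤k k≤1+n not-1-1)) i 1≤i i≤n
    where
    not-1-1 : ¬ (suc n ≡ 1 × k ≡ 1)
    not-1-1 (refl , _) with ≤-trans 1≤i i≤n
    ... | ()

  module _ (y : ℕ → ℕ) where

    B : ℕ → ℕ
    B = FactorialSet X y

    factorialSet-positive : Positive y → ∀ n → 0 < B n
    factorialSet-positive y>0 n =
      prod1-positive _ n (λ j 1≤j _ → ^-positive (y>0 j 1≤j) (X n j))

    factorialSet-extend : ∀ {k n} → 1 ≤ k → k ≤ n → prod1 (λ j → y j ^ X k j) n ≡ B k
    factorialSet-extend {k} 1≤k k≤n = prod1-trailing-ones _ k≤n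
      (λ j k<j _ → cong (y j ^_) (proj₁ (proj₂ array) k j 1≤k (≤-trans 1≤k (<⇒≤ k<j)) k<j))

    factorialSet-quotient-proper : Positive y → ∀ {n k} → 1 ≤ k → k < n →
                                   ∃ λ q → 0 < q × B n ≡ q * (B k * B (n ∸ k))
    factorialSet-quotient-proper y>0 {n} {k} 1≤k k<n =
      q , prod1-positive _ n (λ j 1≤j _ → ^-positive (y>0 j 1≤j) (d j)) , (begin
        B n
          ≡⟨ prod1-^-split y (X k) (X (n ∸ k)) (X n) n
               (λ j 1≤j j≤n → array-superadditive 1≤k k<n 1≤j j≤n) ⟩
        q * (prod1 (λ j → y j ^ X k j) n * prod1 (λ j → y j ^ X (n ∸ k) j) n)
          ≡⟨ cong (q *_) (cong₂ _*_ (factorialSet-extend 1≤k (<⇒≤ k<n))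
                                    (factorialSet-extend (m<n⇒0<n∸m k<n) (m∸n≤m n k))) ⟩
        q * (B k * B (n ∸ k))
          ∎)
      where
      open ≡-Reasoning
      d : ℕ → ℕ
      d j = X n j ∸ (X k j + X (n ∸ k) j)
      q : ℕ
      q = prod1 (λ j → y j ^ d j) n

    factorialSet-quotient : Positive y → ∀ n k → k ≤ n →
                            ∃ λ q → 0 < q × B n ≡ q * (B k * B (n ∸ k))
    factorialSet-quotient y>0 n zero    _   = 1 , s≤s z≤n , sym (trans (*-identityˡ _) (*-identityˡ _))
    factorialSet-quotient y>0 n (suc k) k≤n with m≤n⇒m<n∨m≡n k≤n
    ... | inj₁ k<n  = factorialSet-quotient-proper y>0 (s≤s z≤n) k<n
    ... | inj₂ refl = 1 , s≤s z≤n , sym (begin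
      1 * (B n * B (n ∸ n)) ≡⟨ *-identityˡ _ ⟩
      B n * B (n ∸ n)       ≡⟨ cong (λ m → B n * B m) (n∸n≡0 n) ⟩
      B n * 1               ≡⟨ *-identityʳ (B n) ⟩
      B n                   ∎)
      where open ≡-Reasoning

mainTheorem1 : (x y : ℕ → ℕ) → Positive x → UnboundedAbove x → Positive y →
    (X : ℕ → ℕ → ℕ) → IsArray x X →
    (∀ n → (n !) ∣ FactorialSet X y n) →
    (FactorialSet X y 0 ≡ 1)
    × (∀ n → 0 < FactorialSet X y n)
    × (∀ n k → k ≤ n → ∃ λ q → 0 < q
         × FactorialSet X y n ≡ q * (FactorialSet X y k * FactorialSet X y (n ∸ k)))
    × (∀ n → 1 ≤ n → (n !) ∣ FactorialSet X y n)
mainTheorem1 x y _ _ y>0 X array n!∣B =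
  refl
  , factorialSet-positive array y y>0
  , factorialSet-quotient array y y>0
  , λ n _ → n!∣B n
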